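{- $\{0,1,9\}\subseteq J_{f3}[13]$.
   Context: An $S(2,4,v)$ design is a pair $(\mathcal{V},\mathcal{B})$ with $|\mathcal{V}|=v$ and $\mathcal{B}$ a family of 4-subsets (blocks) of $\mathcal{V}$ such that each 2-subset of $\mathcal{V}$ lies in exactly one block. The flower of an element $x$ is the set of blocks containing $x$. $J_{f3}[v]$ is the set of integers $k$ such that there exist three $S(2,4,v)$ designs on the same point set which share a common flower $F$ (of some element) and whose block sets mutually intersect in the same set of blocks ($\mathcal{B}_1\cap\mathcal{B}_2=\mathcal{B}_1\cap\mathcal{B}_3=\mathcal{B}_2\cap\mathcal{B}_3$), this common set consisting of $F$ together with exactly $k$ further blocks. -}

module Defs where

open import Data.Nat using (ℕ)
open import Data.Fin using (Fin)
open import Data.Fin.Subset using (Subset; ∣_∣) renaming (_∈_ to _∈ₛ_; _∉_ to _∉ₛ_)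
open import Data.List using (List; length)
open import Data.List.Membership.Propositional using (_∈_)
open import Data.List.Relation.Unary.All using (All)
open import Data.List.Relation.Unary.Unique.Propositional using (Unique)
open import Data.Product using (Σ; Σ-syntax; _×_; ∃; ∃-syntax)
open import Data.Sum using (_⊎_)
open import Function.Bundles using (_⇔_)
open import Relation.Binary.PropositionalEquality using (_≡_; _≢_)

Block : ℕ → Set
Block v = Subset v

-- An S(2,4,v) design on point set Fin v.  The block set is represented by a
-- list of blocks, read as a set (membership _∈_; duplicates are irrelevant).
record S24 (v : ℕ) : Set where
  field
    blocks : List (Block v)
    blockSize : All (λ b → ∣ b ∣ ≡ 4) blocks
    covered : ∀ (x y : Fin v) → x ≢ y →
              ∃[ b ] (b ∈ blocks × x ∈ₛ b × y ∈ₛ b)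
    uniqueBlock : ∀ (x y : Fin v) → x ≢ y → ∀ (b b′ : Block v) →
                  b ∈ blocks → x ∈ₛ b → y ∈ₛ b →
                  b′ ∈ blocks → x ∈ₛ b′ → y ∈ₛ b′ → b ≡ b′
open S24 public

_∈B_ : ∀ {v} → Block v → S24 v → Set
b ∈B D = b ∈ blocks D

InFlower : ∀ {v} → Fin v → S24 v → Block v → Set
InFlower x D b = (b ∈B D) × (x ∈ₛ b)

-- k ∈ J_f3[v]: three S(2,4,v) designs on Fin v, an element x whose flower F
-- is common to all three, and a set K of exactly k blocks, disjoint from F,
-- such that B1∩B2 = B1∩B3 = B2∩B3 = F ∪ K.
Jf3 : ℕ → ℕ → Set
Jf3 v k =
  Σ[ D₁ ∈ S24 v ] Σ[ D₂ ∈ S24 v ] Σ[ D₃ ∈ S24 v ] Σ[ x ∈ Fin v ]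
  Σ[ K ∈ List (Block v) ]
    ( Unique K
    × length K ≡ k
    × All (λ b → x ∉ₛ b) K
    × (∀ b → (InFlower x D₁ b ⇔ InFlower x D₂ b)
           × (InFlower x D₁ b ⇔ InFlower x D₃ b))
    × (∀ b → (((b ∈B D₁) × (b ∈B D₂)) ⇔ ((b ∈B D₁) × (b ∈B D₃)))
           × (((b ∈B D₁) × (b ∈B D₂)) ⇔ ((b ∈B D₂) × (b ∈B D₃)))
           × (((b ∈B D₁) × (b ∈B D₂)) ⇔ (InFlower x D₁ b ⊎ b ∈ K))) )

-- An S(2,4,13) is the projective plane of order 3: 13 lines, 4 through each
-- point.  Fix the flower of the point 0 and rearrange the 9 lines off it: one
-- plane taken three times gives k = 9, and two further rearrangements meeting the
-- first plane, and each other, in no off-flower line, respectively only in the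
-- line {1,4,7,12}, give k = 0 and k = 1.  Design axioms and intersections of the
-- explicit block lists are then decided by evaluation.
module Submission where

open import Defs
open import Data.Product using (_×_; _,_)

open import Data.Bool.Properties using () renaming (_≟_ to _≟ᵇ_)
open import Data.Fin using (Fin; zero; suc; #_)
open import Data.Fin.Properties using (_≟_; all?)
open import Data.Fin.Subset using (Subset; ∣_∣; ⁅_⁆; _∪_; _∩_) renaming (_∈_ to _∈ₛ_)
open import Data.Fin.Subset.Properties using (x∈p⇒∣p-x∣<∣p∣; ∣p∣≤∣x∷p∣; x∈p∩q⁺)
  renaming (_∈?_ to _∈ₛ?_)
open import Data.List using (List; []; _∷_; _++_; filter; length)
open import Data.List.Membership.Propositional using (_∈_; find)
open import Data.List.Membership.Propositional.Properties using (∈-filter⁺; ∈-filter⁻; ++-∈⇔)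
import Data.List.Membership.DecPropositional as DecMembership
open import Data.List.Relation.Unary.All as All using (All) renaming (all? to allᴸ?)
open import Data.List.Relation.Unary.Any using (Any; any?)
open import Data.List.Relation.Unary.Unique.DecPropositional using (unique?)
open import Data.Nat as ℕ using (ℕ; _≤_; _<_; _≤?_; _<?_; s≤s)
open import Data.Nat.Properties using (≤-trans; m<n⇒0<n)
open import Data.Sum using (_⊎_; inj₁; inj₂)
open import Data.Sum.Function.Propositional using (_⊎-⇔_)
open import Data.Vec.Base as Vec using (here; there)
open import Data.Vec.Properties using (≡-dec)
open import Function.Bundles using (_⇔_; mk⇔)
open import Function.Construct.Identity using (⇔-id)
open import Function.Construct.Symmetry using (⇔-sym)
open import Function.Related.Propositional using (module EquationalReasoning)
open import Relation.Binary.Definitions using (DecidableEquality)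
open import Relation.Binary.PropositionalEquality using (_≡_; _≢_; refl; cong)
open import Relation.Nullary using (Dec; ¬?; contradiction)
open import Relation.Nullary.Decidable using (True; toWitness; _×-dec_; _⊎-dec_; _→-dec_)

private
  variable
    v : ℕ

block : (a b c d : ℕ) {a<v : True (a <? v)} {b<v : True (b <? v)}
        {c<v : True (c <? v)} {d<v : True (d <? v)} → Block v
block a b c d {a<v} {b<v} {c<v} {d<v} =
  ⁅ (# a) {m<n = a<v} ⁆ ∪ ⁅ (# b) {m<n = b<v} ⁆ ∪ ⁅ (# c) {m<n = c<v} ⁆ ∪ ⁅ (# d) {m<n = d<v} ⁆

_≟ᴮ_ : DecidableEquality (Block v)
_≟ᴮ_ = ≡-dec _≟ᵇ_

x∈p⇒0<∣p∣ : ∀ {x : Fin v} {p : Subset v} → x ∈ₛ p → 0 < ∣ p ∣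
x∈p⇒0<∣p∣ x∈p = m<n⇒0<n (x∈p⇒∣p-x∣<∣p∣ x∈p)

∣p∣≤1⇒x∈p⇒y∈p⇒x≡y : ∀ {x y : Fin v} {p : Subset v} → ∣ p ∣ ≤ 1 → x ∈ₛ p → y ∈ₛ p → x ≡ y
∣p∣≤1⇒x∈p⇒y∈p⇒x≡y _            here        here        = refl
∣p∣≤1⇒x∈p⇒y∈p⇒x≡y (s≤s ∣p∣≤0) here        (there y∈p) = contradiction (≤-trans (x∈p⇒0<∣p∣ y∈p) ∣p∣≤0) λ ()
∣p∣≤1⇒x∈p⇒y∈p⇒x≡y (s≤s ∣p∣≤0) (there x∈p) here        = contradiction (≤-trans (x∈p⇒0<∣p∣ x∈p) ∣p∣≤0) λ ()
∣p∣≤1⇒x∈p⇒y∈p⇒x≡y {p = s Vec.∷ p} ∣p∣≤1 (there x∈p) (there y∈p) =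
  cong suc (∣p∣≤1⇒x∈p⇒y∈p⇒x≡y (≤-trans (∣p∣≤∣x∷p∣ s p) ∣p∣≤1) x∈p y∈p)

CoversPairs : List (Block v) → Set
CoversPairs {v} L = ∀ (x y : Fin v) → x ≢ y → Any (λ b → x ∈ₛ b × y ∈ₛ b) L

PairwiseMeetInAtMostOnePoint : List (Block v) → Set
PairwiseMeetInAtMostOnePoint L = All (λ b → All (λ b′ → b ≡ b′ ⊎ ∣ b ∩ b′ ∣ ≤ 1) L) L

coversPairs? : (L : List (Block v)) → Dec (CoversPairs L)
coversPairs? L = all? λ x → all? λ y →
  ¬? (x ≟ y) →-dec any? (λ b → x ∈ₛ? b ×-dec y ∈ₛ? b) L

pairwiseMeetInAtMostOnePoint? : (L : List (Block v)) → Dec (PairwiseMeetInAtMostOnePoint L)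
pairwiseMeetInAtMostOnePoint? L =
  allᴸ? (λ b → allᴸ? (λ b′ → b ≟ᴮ b′ ⊎-dec ∣ b ∩ b′ ∣ ≤? 1) L) L

mkS24 : (L : List (Block v)) → True (allᴸ? (λ b → ∣ b ∣ ℕ.≟ 4) L) →
        True (coversPairs? L) → True (pairwiseMeetInAtMostOnePoint? L) → S24 v
mkS24 L sizes covers meets = record
  { blocks      = L
  ; blockSize   = toWitness sizes
  ; covered     = λ x y x≢y → find (toWitness covers x y x≢y)
  ; uniqueBlock = unique
  }
  where
  unique : ∀ (x y : Fin _) → x ≢ y → ∀ b b′ → b ∈ L → x ∈ₛ b → y ∈ₛ b →
           b′ ∈ L → x ∈ₛ b′ → y ∈ₛ b′ → b ≡ b′
  unique x y x≢y b b′ b∈L x∈b y∈b b′∈L x∈b′ y∈b′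
    with All.lookup (All.lookup (toWitness meets) b∈L) b′∈L
  ... | inj₁ b≡b′   = b≡b′
  ... | inj₂ ∣b∩b′∣≤1 = contradiction
        (∣p∣≤1⇒x∈p⇒y∈p⇒x≡y ∣b∩b′∣≤1 (x∈p∩q⁺ (x∈b , x∈b′)) (x∈p∩q⁺ (y∈b , y∈b′))) x≢y

common : List (Block v) → List (Block v) → List (Block v)
common L₁ L₂ = filter (λ b → b ∈? L₂) L₁
  where open DecMembership _≟ᴮ_ using (_∈?_)

flower : Fin v → List (Block v) → List (Block v)
flower x = filter (x ∈ₛ?_)

∈-common : ∀ {b : Block v} L₁ L₂ → b ∈ common L₁ L₂ ⇔ (b ∈ L₁ × b ∈ L₂)
∈-common L₁ L₂ = mk⇔ (∈-filter⁻ _) λ (b∈L₁ , b∈L₂) → ∈-filter⁺ _ b∈L₁ b∈L₂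

∈-flower : ∀ {b : Block v} x L → b ∈ flower x L ⇔ (b ∈ L × x ∈ₛ b)
∈-flower x L = mk⇔ (∈-filter⁻ _) λ (b∈L , x∈b) → ∈-filter⁺ _ b∈L x∈b

≡⇒∈⇔ : ∀ {b : Block v} {L L′} → L ≡ L′ → b ∈ L ⇔ b ∈ L′
≡⇒∈⇔ refl = ⇔-id _

common-≡⇒⇔ : ∀ {b : Block v} {L₁ L₂ L₃ L₄} → common L₁ L₂ ≡ common L₃ L₄ →
             (b ∈ L₁ × b ∈ L₂) ⇔ (b ∈ L₃ × b ∈ L₄)
common-≡⇒⇔ {b = b} {L₁} {L₂} {L₃} {L₄} eq = begin
  (b ∈ L₁ × b ∈ L₂)   ∼⟨ ⇔-sym (∈-common L₁ L₂) ⟩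
  b ∈ common L₁ L₂    ∼⟨ ≡⇒∈⇔ eq ⟩
  b ∈ common L₃ L₄    ∼⟨ ∈-common L₃ L₄ ⟩
  (b ∈ L₃ × b ∈ L₄)   ∎
  where open EquationalReasoning

flower-≡⇒⇔ : ∀ {b : Block v} {x L L′} → flower x L ≡ flower x L′ →
             (b ∈ L × x ∈ₛ b) ⇔ (b ∈ L′ × x ∈ₛ b)
flower-≡⇒⇔ {b = b} {x} {L} {L′} eq = begin
  (b ∈ L × x ∈ₛ b)    ∼⟨ ⇔-sym (∈-flower x L) ⟩
  b ∈ flower x L      ∼⟨ ≡⇒∈⇔ eq ⟩
  b ∈ flower x L′     ∼⟨ ∈-flower x L′ ⟩
  (b ∈ L′ × x ∈ₛ b)   ∎
  where open EquationalReasoning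

common-≡-flower++⇒⇔ : ∀ {b : Block v} {x L L′ K} → common L L′ ≡ flower x L ++ K →
                      (b ∈ L × b ∈ L′) ⇔ ((b ∈ L × x ∈ₛ b) ⊎ b ∈ K)
common-≡-flower++⇒⇔ {b = b} {x} {L} {L′} {K} eq = begin
  (b ∈ L × b ∈ L′)              ∼⟨ ⇔-sym (∈-common L L′) ⟩
  b ∈ common L L′               ∼⟨ ≡⇒∈⇔ eq ⟩
  b ∈ flower x L ++ K           ∼⟨ ++-∈⇔ ⟩
  (b ∈ flower x L ⊎ b ∈ K)      ∼⟨ ∈-flower x L ⊎-⇔ ⇔-id _ ⟩
  ((b ∈ L × x ∈ₛ b) ⊎ b ∈ K)    ∎
  where open EquationalReasoning

-- The equalities are between lists, to be discharged by refl; note that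
-- common L₁ L₂ and flower x L₁ keep the order of L₁.
mkJf3 : (D₁ D₂ D₃ : S24 v) (x : Fin v) (K : List (Block v)) →
        let B₁ = blocks D₁ ; B₂ = blocks D₂ ; B₃ = blocks D₃ in
        True (unique? _≟ᴮ_ K) → True (allᴸ? (λ b → ¬? (x ∈ₛ? b)) K) →
        flower x B₁ ≡ flower x B₂ → flower x B₁ ≡ flower x B₃ →
        common B₁ B₂ ≡ common B₁ B₃ → common B₁ B₂ ≡ common B₂ B₃ →
        common B₁ B₂ ≡ flower x B₁ ++ K →
        Jf3 v (length K)
mkJf3 D₁ D₂ D₃ x K K-unique x∉K F₁₂ F₁₃ C₁₂₌₁₃ C₁₂₌₂₃ C₁₂₌F+K =
  D₁ , D₂ , D₃ , x , K , toWitness K-unique , refl , toWitness x∉K ,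
  (λ _ → flower-≡⇒⇔ F₁₂ , flower-≡⇒⇔ F₁₃) ,
  (λ _ → common-≡⇒⇔ C₁₂₌₁₃ , common-≡⇒⇔ C₁₂₌₂₃ , common-≡-flower++⇒⇔ C₁₂₌F+K)

flowerOf0 : List (Block 13)
flowerOf0 = block 0 7 8 9 ∷ block 0 4 5 6 ∷ block 0 1 2 3 ∷ block 0 10 11 12 ∷ []

planeOffFlower : List (Block 13)
planeOffFlower =
  block 3 4 9 11 ∷ block 2 6 7 11 ∷ block 1 5 8 11 ∷ block 3 5 7 10 ∷ block 1 6 9 10 ∷
  block 1 4 7 12 ∷ block 3 6 8 12 ∷ block 2 5 9 12 ∷ block 2 4 8 10 ∷ []

plane : S24 13
plane = mkS24 (flowerOf0 ++ planeOffFlower) _ _ _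

disjointPlane₁ : S24 13
disjointPlane₁ = mkS24 (flowerOf0 ++
  block 1 6 9 12 ∷ block 1 4 7 11 ∷ block 3 6 7 10 ∷ block 2 5 7 12 ∷ block 1 5 8 10 ∷
  block 2 6 8 11 ∷ block 3 5 9 11 ∷ block 3 4 8 12 ∷ block 2 4 9 10 ∷ []) _ _ _

disjointPlane₂ : S24 13
disjointPlane₂ = mkS24 (flowerOf0 ++
  block 1 4 9 11 ∷ block 3 4 8 10 ∷ block 2 4 7 12 ∷ block 1 5 7 10 ∷ block 2 5 8 11 ∷
  block 3 6 7 11 ∷ block 2 6 9 10 ∷ block 1 6 8 12 ∷ block 3 5 9 12 ∷ []) _ _ _

touchingPlane₁ : S24 13
touchingPlane₁ = mkS24 (flowerOf0 ++
  block 1 4 7 12 ∷ block 2 6 8 12 ∷ block 2 5 7 11 ∷ block 3 6 7 10 ∷ block 3 4 8 11 ∷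
  block 1 5 8 10 ∷ block 1 6 9 11 ∷ block 3 5 9 12 ∷ block 2 4 9 10 ∷ []) _ _ _

touchingPlane₂ : S24 13
touchingPlane₂ = mkS24 (flowerOf0 ++
  block 1 4 7 12 ∷ block 2 5 7 10 ∷ block 1 6 8 10 ∷ block 2 4 8 11 ∷ block 3 6 7 11 ∷
  block 1 5 9 11 ∷ block 3 4 9 10 ∷ block 3 5 8 12 ∷ block 2 6 9 12 ∷ []) _ _ _

corollary4p9 : Jf3 13 0 × Jf3 13 1 × Jf3 13 9
corollary4p9 =
  mkJf3 plane disjointPlane₁ disjointPlane₂ zero [] _ _ refl refl refl refl refl ,
  mkJf3 plane touchingPlane₁ touchingPlane₂ zero (block 1 4 7 12 ∷ []) _ _ refl refl refl refl refl ,
  mkJf3 plane plane plane zero planeOffFlower _ _ refl refl refl refl refl
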